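{- Let $G$ and $G'$ be reduction graphs, let $\langle a\rangle\in V(G)$ be a node of $G$, and let $\langle a'\rangle$ be the root of $G'$. Let $G''$ be obtained by forming the scaled graphs $a'G$ and $aG'$ (every node $X$ replaced by $a'X$, resp. $aX$, with the same edges and weights) and identifying the node $\langle a'a\rangle$ of $a'G$ (the image of $\langle a\rangle$) with the root $\langle aa'\rangle$ of $aG'$. Then $G''$ is a reduction graph, $S(G'') = a'S(G) + aS(G')$, $\mathrm{Bal}(G'') = \mathrm{Bal}(G)\cdot\mathrm{Bal}(G')$, and $A(G'') = a'A(G) + aA(G')$. In particular, the composition of two symmetric reduction graphs is symmetric. Moreover, composition by the root (the case where $\langle a\rangle$ is the root of $G$) is commutative and associative.
   Context: $\mathbb{N}$ = nonnegative integers; $\langle a\rangle := \{an : n\in\mathbb{N}\}$; $kX := \{kx : x\in X\}$. For sets $A,B$, $A+B := \{a+b\}$; $C=A\oplus B$ means $C=A+B$ with unique representations. For a (possibly infinite) family of sets containing $0$, $\sum_i A_i$ is the set of all finite sums of elements from distinct members. A reduction graph $G$ consists of a multicollection $V(G)$ of nodes (nonempty subsets of $\mathbb{N}$ containing $0$) and a finite set $E(G)$ of hyperedges; each edge $e$ has input nodes $B_j$ and output nodes $A_i$ and a finite remainder set $\mathrm{Rem}(e)$ with $\sum_i A_i + \sum_j B_j = (\sum_i A_i)\oplus\mathrm{Rem}(e)$, weight $w(e):=|\mathrm{Rem}(e)|$. Viewing edges as arrows from inputs to outputs, $G$ is acyclic; exactly one node (the root) is an input of no edge and equals $\langle r(G)\rangle$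 for a positive integer $r(G)$; every other node is an input of exactly one edge. $S(G) := \sum_{X\in V(G)}X$; $\mathrm{Bal}(G) := r(G)/\prod_e w(e)$. The asymmetry of an edge is $A(e) := 2\mu(\mathrm{Rem}(e)) - \max(\mathrm{Rem}(e))$ ($\mu$ = arithmetic mean), $A(G):=\sum_e A(e)$, and $G$ is symmetric if $A(G)=0$. -}

module Defs where

open import Level using (0ℓ)
open import Data.Nat as ℕ using (ℕ; zero; suc; _*_; _⊔_; NonZero)
open import Data.Nat.Properties using (m*n≢0)
open import Data.Nat.ListAction using (sum)
import Data.Nat as N
open import Data.Integer as ℤ using (ℤ; +_)
open import Data.Rational as ℚ using (ℚ; 0ℚ)
open import Data.Fin as Fin using (Fin; splitAt; punchIn; punchOut; _↑ˡ_; _↑ʳ_; _≟_)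
open import Data.List as List using (List; []; _∷_; map; _++_; length)
open import Data.List.Membership.Propositional using (_∈_; _∉_)
open import Data.List.Relation.Unary.Any using (here; there)
open import Data.List.Relation.Unary.Unique.Propositional using (Unique)
open import Data.List.Relation.Binary.Permutation.Propositional using (_↭_)
open import Data.Product using (Σ; ∃; _×_; _,_; proj₁; proj₂)
open import Data.Sum using ([_,_]′)
open import Relation.Binary.PropositionalEquality using (_≡_; _≢_; refl)
open import Relation.Binary.Construct.Closure.Transitive using (TransClosure)
open import Relation.Nullary using (¬_; yes; no)
open import Function.Bundles using (_↔_; Inverse)

SetN : Set₁
SetN = ℕ → Set

_≐_ : SetN → SetN → Set
X ≐ Y = ∀ n → (X n → Y n) × (Y n → X n)

⟨_⟩ : ℕ → SetN
⟨ a ⟩ x = ∃ λ k → x ≡ a * k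

_⋅_ : ℕ → SetN → SetN
(c ⋅ X) y = ∃ λ x → X x × y ≡ c * x

_+ˢ_ : SetN → SetN → SetN
(A +ˢ B) y = ∃ λ a → ∃ λ b → A a × B b × y ≡ a N.+ b

IsDirectSum : SetN → SetN → SetN → Set
IsDirectSum C A B =
  (C ≐ (A +ˢ B)) ×
  (∀ a b a' b' → A a → B b → A a' → B b' → a N.+ b ≡ a' N.+ b' → a ≡ a' × b ≡ b')

fromList : List ℕ → SetN
fromList l x = x ∈ l

-- sum of a finite family of sets (each containing 0): all sums of one
-- element from each member (equivalently, finite sums of elements from
-- distinct members).  Empty sum = {0}.
sumL : List SetN → SetN
sumL []       x = x ≡ 0
sumL (X ∷ Xs) = X +ˢ sumL Xs

⨁ : ∀ {n} → (Fin n → SetN) → SetN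
⨁ {zero}  f x = x ≡ 0
⨁ {suc n} f   = f Fin.zero +ˢ ⨁ (λ i → f (Fin.suc i))

prodFin : ∀ {n} → (Fin n → ℕ) → ℕ
prodFin {zero}  f = 1
prodFin {suc n} f = f Fin.zero * prodFin (λ i → f (Fin.suc i))

sumFinℚ : ∀ {n} → (Fin n → ℚ) → ℚ
sumFinℚ {zero}  f = 0ℚ
sumFinℚ {suc n} f = f Fin.zero ℚ.+ sumFinℚ (λ i → f (Fin.suc i))

maxL : List ℕ → ℕ
maxL = List.foldr _⊔_ 0

-- Nodes are indexed by Fin (suc n) (a multicollection; the node count is
-- suc n since the root exists); edges by Fin m.  Each edge e has a list of
-- input nodes ins e (the B_j), output nodes outs e (the A_i) and a finite
-- remainder set rem e given as a list (with no repetitions, by IsRG).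

record PreGraph : Set₁ where
  field
    n    : ℕ
    m    : ℕ
    node : Fin (suc n) → SetN
    ins  : Fin m → List (Fin (suc n))
    outs : Fin m → List (Fin (suc n))
    rem  : Fin m → List ℕ
    root : Fin (suc n)
    r    : ℕ
open PreGraph public

Arrow : (G : PreGraph) → Fin (suc (n G)) → Fin (suc (n G)) → Set
Arrow G i j = Σ (Fin (m G)) λ e → i ∈ ins G e × j ∈ outs G e

OutSum : (G : PreGraph) → Fin (m G) → SetN
OutSum G e = sumL (map (node G) (outs G e))

InSum : (G : PreGraph) → Fin (m G) → SetN
InSum G e = sumL (map (node G) (ins G e))

record IsRG (G : PreGraph) : Set where
  field
    node-0        : ∀ i → node G i 0
    edge-unique   : ∀ e → Unique (outs G e ++ ins G e)
    rem-unique    : ∀ e → Unique (rem G e)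
    edge-sum      : ∀ e → IsDirectSum (OutSum G e +ˢ InSum G e) (OutSum G e) (fromList (rem G e))
    acyclic       : ∀ i → ¬ TransClosure (Arrow G) i i
    root-no-input : ∀ e → root G ∉ ins G e
    nonroot-input : ∀ j → j ≢ root G →
                    Σ (Fin (m G)) λ e → j ∈ ins G e × (∀ e' → j ∈ ins G e' → e' ≡ e)
    r-pos         : NonZero (r G)
    root-node     : node G (root G) ≐ ⟨ r G ⟩
open IsRG public

w : (G : PreGraph) → Fin (m G) → ℕ
w G e = length (rem G e)

private
  sumL-0 : ∀ (Xs : List SetN) → (∀ X → X ∈ Xs → X 0) → sumL Xs 0
  sumL-0 []       h = refl
  sumL-0 (X ∷ Xs) h = 0 , 0 , h X (here refl) , sumL-0 Xs (λ Y p → h Y (there p)) , refl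

  map-∈ : ∀ {k} (f : Fin k → SetN) (l : List (Fin k)) X → X ∈ map f l → ∃ λ i → X ≡ f i
  map-∈ f (i ∷ l) X (here p)  = i , p
  map-∈ f (i ∷ l) X (there p) = map-∈ f l X p

  allNode0 : ∀ {G} → IsRG G → ∀ (l : List (Fin (suc (n G)))) → sumL (map (node G) l) 0
  allNode0 {G} h l = sumL-0 (map (node G) l) λ X p → helper (map-∈ (node G) l X p)
    where
      helper : ∀ {X} → (∃ λ i → X ≡ node G i) → X 0
      helper (i , refl) = node-0 h i

  nonEmpty : ∀ (l : List ℕ) x → x ∈ l → NonZero (length l)
  nonEmpty (_ ∷ _) _ _ = _

w-nonZero : ∀ {G} → IsRG G → ∀ e → NonZero (w G e)
w-nonZero {G} h e with proj₁ (proj₁ (edge-sum h e) 0)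
                        (0 , 0 , allNode0 h (outs G e) , allNode0 h (ins G e) , refl)
... | s , x , _ , x∈ , _ = nonEmpty (rem G e) x x∈

prod-nonZero : ∀ {k} (f : Fin k → ℕ) → (∀ i → NonZero (f i)) → NonZero (prodFin f)
prod-nonZero {zero}  f h = _
prod-nonZero {suc k} f h =
  m*n≢0 (f Fin.zero) (prodFin (λ i → f (Fin.suc i)))
    {{h Fin.zero}} {{prod-nonZero (λ i → f (Fin.suc i)) (λ i → h (Fin.suc i))}}

S : PreGraph → SetN
S G = ⨁ (node G)

Bal : (G : PreGraph) → IsRG G → ℚ
Bal G h = ℚ._/_ (+ r G) (prodFin (w G)) {{prod-nonZero (w G) (w-nonZero h)}}

Asym-e : (G : PreGraph) → IsRG G → Fin (m G) → ℚ
Asym-e G h e =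
  ℚ._/_ (+ (2 * sum (rem G e))) (w G e) {{w-nonZero h e}}
  ℚ.- ℚ._/_ (+ maxL (rem G e)) 1

Asym : (G : PreGraph) → IsRG G → ℚ
Asym G h = sumFinℚ (Asym-e G h)

Symmetric : (G : PreGraph) → IsRG G → Set
Symmetric G h = Asym G h ≡ 0ℚ

-- Nodes of G'': Fin (suc (n G) + n G'); the first suc (n G) are the nodes
-- of G (scaled by a'), the remaining n G' are the non-root nodes of G'
-- (scaled by a), enumerated via punchIn/punchOut around root G'.

embedG' : ∀ {p q} → Fin (suc p) → Fin (suc q) → Fin (suc q) → Fin (suc p N.+ q)
embedG' {p} {q} k rt j with rt ≟ j
... | yes _ = k ↑ˡ q
... | no ne = suc p ↑ʳ punchOut ne

compose : (G : PreGraph) → Fin (suc (n G)) → ℕ → (G' : PreGraph) → PreGraph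
compose G k a G' = record
  { n    = n G N.+ n G'
  ; m    = m G N.+ m G'
  ; node = λ i → [ (λ x → r G' ⋅ node G x)
                 , (λ y → a ⋅ node G' (punchIn (root G') y)) ]′ (splitAt (suc (n G)) i)
  ; ins  = λ e → [ (λ f → map e₁ (ins G f)) , (λ f → map e₂ (ins G' f)) ]′ (splitAt (m G) e)
  ; outs = λ e → [ (λ f → map e₁ (outs G f)) , (λ f → map e₂ (outs G' f)) ]′ (splitAt (m G) e)
  ; rem  = λ e → [ (λ f → map (r G' *_) (rem G f)) , (λ f → map (a *_) (rem G' f)) ]′ (splitAt (m G) e)
  ; root = e₁ (root G)
  ; r    = r G' * r G
  }
  where
    e₁ : Fin (suc (n G)) → Fin (suc (n G) N.+ n G')
    e₁ x = x ↑ˡ n G'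
    e₂ : Fin (suc (n G')) → Fin (suc (n G) N.+ n G')
    e₂ = embedG' k (root G')

_∘ʳ_ : PreGraph → PreGraph → PreGraph
G ∘ʳ G' = compose G (root G) (r G) G'

record _≅_ (G H : PreGraph) : Set where
  field
    nodeIso  : Fin (suc (n G)) ↔ Fin (suc (n H))
    edgeIso  : Fin (m G) ↔ Fin (m H)
    node-iso : ∀ i → node G i ≐ node H (Inverse.to nodeIso i)
    ins-iso  : ∀ e → map (Inverse.to nodeIso) (ins G e) ↭ ins H (Inverse.to edgeIso e)
    outs-iso : ∀ e → map (Inverse.to nodeIso) (outs G e) ↭ outs H (Inverse.to edgeIso e)
    rem-iso  : ∀ e → rem G e ↭ rem H (Inverse.to edgeIso e)
    root-iso : Inverse.to nodeIso (root G) ≡ root H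
    r-iso    : r G ≡ r H

-- The nodes of the composite form the pushout of those of G and G' along k ↦ root G', its edges
-- the disjoint union.  Multiplying every node and remainder of an edge by a nonzero constant
-- preserves the direct-sum condition, so each edge of a'G and aG' is still an edge, and a path
-- that enters the a'G part never leaves it, so cycles cannot arise.  The glued node ⟨a'a⟩ is
-- idempotent under +, so it contributes nothing new to S.  Weights are unchanged and scaling a
-- remainder set scales its asymmetry, which gives Bal and A edge by edge.  For composition by the
-- root, the evident maps between the pushouts are mutually inverse isomorphisms.
module Submission where

open import Defs
open import Level using (0ℓ) renaming (suc to lsuc)
open import Data.Nat as ℕ using (ℕ; suc; _<_; NonZero; >-nonZero)
import Data.Nat.Properties as ℕ
open import Data.Nat.ListAction using (sum)
open import Data.Integer as ℤ using (+_)
import Data.Integer.Properties as ℤ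
open import Data.Rational as ℚ using (ℚ; 0ℚ; _/_; _*_; _+_; _-_; toℚᵘ)
import Data.Rational.Properties as ℚ
import Data.Rational.Unnormalised as ℚᵘ
import Data.Rational.Unnormalised.Properties as ℚᵘ
open import Data.Fin as Fin using (Fin; splitAt; punchIn; punchOut; _↑ˡ_; _↑ʳ_; _≟_)
open import Data.Fin.Properties
  using (splitAt-↑ˡ; splitAt-↑ʳ; splitAt⁻¹-↑ˡ; splitAt⁻¹-↑ʳ; +↔⊎; ↑ˡ-injective; ↑ʳ-injective;
         punchOut-cong; punchIn-punchOut; punchOut-punchIn; punchInᵢ≢i; punchOut-injective)
open import Data.List using (List; []; _∷_; map; _++_; length)
open import Data.List.Properties using (map-∘; map-cong; map-++; length-map)
open import Data.List.Membership.Propositional using (_∈_; _∉_)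
open import Data.List.Membership.Propositional.Properties using (∈-map⁺; ∈-map⁻)
open import Data.List.Relation.Unary.Unique.Propositional using (Unique)
import Data.List.Relation.Unary.Unique.Propositional.Properties as Unique
open import Data.List.Relation.Binary.Permutation.Propositional using (↭-reflexive)
open import Data.Product using (Σ; ∃; _×_; _,_; proj₁; proj₂)
open import Data.Sum using (inj₁; inj₂; [_,_]′)
open import Data.Sum.Algebra using (⊎-comm; ⊎-assoc)
open import Data.Sum.Function.Propositional using (_⊎-↔_)
open import Data.Empty using (⊥-elim)
open import Function using (_∘_; id; _↔_; Inverse; mk↔ₛ′)
open import Function.Properties.Inverse using (↔-refl; ↔-sym; ↔-trans)
open import Relation.Nullary using (¬_; Dec; yes; no)
open import Relation.Binary using (Setoid; Rel; Reflexive)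
import Relation.Binary.Reasoning.Setoid as SetoidReasoning
open import Relation.Binary.PropositionalEquality
open import Relation.Binary.Construct.Closure.Transitive using (TransClosure; [_]; _∷_)
open import Algebra.Properties.CommutativeSemigroup ℕ.*-commutativeSemigroup using (x∙yz≈y∙xz)

｛0｝ : SetN
｛0｝ x = x ≡ 0

≐-refl : ∀ {X} → X ≐ X
≐-refl _ = id , id

≐-sym : ∀ {X Y} → X ≐ Y → Y ≐ X
≐-sym p x = proj₂ (p x) , proj₁ (p x)

≐-trans : ∀ {X Y Z} → X ≐ Y → Y ≐ Z → X ≐ Z
≐-trans p q x = proj₁ (q x) ∘ proj₁ (p x) , proj₂ (p x) ∘ proj₂ (q x)

≐-reflexive : ∀ {X Y} → X ≡ Y → X ≐ Y
≐-reflexive refl = ≐-refl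

≐-setoid : Setoid (lsuc 0ℓ) 0ℓ
≐-setoid = record
  { Carrier       = SetN
  ; _≈_           = _≐_
  ; isEquivalence = record { refl = ≐-refl ; sym = ≐-sym ; trans = ≐-trans }
  }

module ≐-Reasoning = SetoidReasoning ≐-setoid

+ˢ-cong : ∀ {A A' B B'} → A ≐ A' → B ≐ B' → (A +ˢ B) ≐ (A' +ˢ B')
+ˢ-cong p q _ = (λ (x , y , ax , by , e) → x , y , proj₁ (p x) ax , proj₁ (q y) by , e)
              , (λ (x , y , ax , by , e) → x , y , proj₂ (p x) ax , proj₂ (q y) by , e)

+ˢ-comm : ∀ {A B} → (A +ˢ B) ≐ (B +ˢ A)
+ˢ-comm _ = swap+ , swap+
  where
    swap+ : ∀ {A B z} → (A +ˢ B) z → (B +ˢ A) z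
    swap+ (x , y , ax , by , e) = y , x , by , ax , trans e (ℕ.+-comm x y)

+ˢ-assoc : ∀ {A B C} → ((A +ˢ B) +ˢ C) ≐ (A +ˢ (B +ˢ C))
+ˢ-assoc _ =
    (λ { (_ , z , (x , y , ax , by , refl) , cz , e) →
         x , y ℕ.+ z , ax , (y , z , by , cz , refl) , trans e (ℕ.+-assoc x y z) })
  , (λ { (x , _ , ax , (y , z , by , cz , refl) , e) →
         x ℕ.+ y , z , (x , y , ax , by , refl) , cz , trans e (sym (ℕ.+-assoc x y z)) })

+ˢ-identityˡ : ∀ {A} → (｛0｝ +ˢ A) ≐ A
+ˢ-identityˡ x = (λ { (_ , _ , refl , ay , refl) → ay }) , (λ ax → 0 , x , refl , ax , refl)

+ˢ-leftComm : ∀ {A B C} → (A +ˢ (B +ˢ C)) ≐ (B +ˢ (A +ˢ C))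
+ˢ-leftComm = ≐-trans (≐-sym +ˢ-assoc) (≐-trans (+ˢ-cong +ˢ-comm ≐-refl) +ˢ-assoc)

+ˢ-absorbʳ : ∀ {P B P'} → P ≐ (B +ˢ P') → (B +ˢ B) ≐ B → (P +ˢ B) ≐ P
+ˢ-absorbʳ {P} {B} {P'} P≐B+P' B+B≐B = begin
  P +ˢ B             ≈⟨ +ˢ-cong P≐B+P' ≐-refl ⟩
  (B +ˢ P') +ˢ B     ≈⟨ +ˢ-assoc ⟩
  B +ˢ (P' +ˢ B)     ≈⟨ +ˢ-cong ≐-refl +ˢ-comm ⟩
  B +ˢ (B +ˢ P')     ≈⟨ +ˢ-assoc ⟨
  (B +ˢ B) +ˢ P'     ≈⟨ +ˢ-cong B+B≐B ≐-refl ⟩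
  B +ˢ P'            ≈⟨ P≐B+P' ⟨
  P                  ∎
  where open ≐-Reasoning

⋅-cong : ∀ c {X Y} → X ≐ Y → (c ⋅ X) ≐ (c ⋅ Y)
⋅-cong c p _ = (λ (x , xX , e) → x , proj₁ (p x) xX , e) , (λ (x , xY , e) → x , proj₂ (p x) xY , e)

⋅-distribˡ-+ˢ : ∀ c {A B} → (c ⋅ (A +ˢ B)) ≐ ((c ⋅ A) +ˢ (c ⋅ B))
⋅-distribˡ-+ˢ c _ =
    (λ { (_ , (x , y , ax , by , refl) , e) →
         c ℕ.* x , c ℕ.* y , (x , ax , refl) , (y , by , refl) , trans e (ℕ.*-distribˡ-+ c x y) })
  , (λ { (_ , _ , (x , ax , refl) , (y , by , refl) , e) →
         x ℕ.+ y , (x , y , ax , by , refl) , trans e (sym (ℕ.*-distribˡ-+ c x y)) })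

⋅-assoc : ∀ c d {X} → (c ⋅ (d ⋅ X)) ≐ ((c ℕ.* d) ⋅ X)
⋅-assoc c d _ = (λ { (_ , (x , xX , refl) , e) → x , xX , trans e (sym (ℕ.*-assoc c d x)) })
              , (λ (x , xX , e) → d ℕ.* x , (x , xX , refl) , trans e (ℕ.*-assoc c d x))

⋅-comm : ∀ c d {X} → (c ⋅ (d ⋅ X)) ≐ (d ⋅ (c ⋅ X))
⋅-comm c d {X} = begin
  c ⋅ (d ⋅ X)      ≈⟨ ⋅-assoc c d ⟩
  (c ℕ.* d) ⋅ X    ≡⟨ cong (_⋅ X) (ℕ.*-comm c d) ⟩
  (d ℕ.* c) ⋅ X    ≈⟨ ⋅-assoc d c ⟨
  d ⋅ (c ⋅ X)      ∎
  where open ≐-Reasoning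

⋅-｛0｝ : ∀ c → (c ⋅ ｛0｝) ≐ ｛0｝
⋅-｛0｝ c _ = (λ { (_ , refl , e) → trans e (ℕ.*-zeroʳ c) }) , (λ e → 0 , refl , trans e (sym (ℕ.*-zeroʳ c)))

⋅-⟨⟩ : ∀ c d → (c ⋅ ⟨ d ⟩) ≐ ⟨ c ℕ.* d ⟩
⋅-⟨⟩ c d _ = (λ { (_ , (j , refl) , e) → j , trans e (sym (ℕ.*-assoc c d j)) })
           , (λ (j , e) → d ℕ.* j , (j , refl) , trans e (ℕ.*-assoc c d j))

⟨⟩-+ˢ-idem : ∀ b → (⟨ b ⟩ +ˢ ⟨ b ⟩) ≐ ⟨ b ⟩
⟨⟩-+ˢ-idem b x =
    (λ { (_ , _ , (i , refl) , (j , refl) , e) → i ℕ.+ j , trans e (sym (ℕ.*-distribˡ-+ b i j)) })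
  , (λ x∈ → x , 0 , x∈ , (0 , sym (ℕ.*-zeroʳ b)) , sym (ℕ.+-identityʳ x))

IsDirectSum-resp : ∀ {C A B C' A' B'} → C ≐ C' → A ≐ A' → B ≐ B' →
                   IsDirectSum C A B → IsDirectSum C' A' B'
IsDirectSum-resp C≐ A≐ B≐ (C≐A+B , unique) =
    ≐-trans (≐-sym C≐) (≐-trans C≐A+B (+ˢ-cong A≐ B≐))
  , λ x y x' y' ax by ax' by' →
      unique x y x' y' (proj₂ (A≐ x) ax) (proj₂ (B≐ y) by) (proj₂ (A≐ x') ax') (proj₂ (B≐ y') by')

IsDirectSum-⋅ : ∀ c .{{_ : NonZero c}} {C A B} →
                IsDirectSum C A B → IsDirectSum (c ⋅ C) (c ⋅ A) (c ⋅ B)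
IsDirectSum-⋅ c {C} {A} {B} (C≐A+B , unique) = ≐-trans (⋅-cong c C≐A+B) (⋅-distribˡ-+ˢ c) , unique-⋅
  where
    unique-⋅ : ∀ x y x' y' → (c ⋅ A) x → (c ⋅ B) y → (c ⋅ A) x' → (c ⋅ B) y' →
               x ℕ.+ y ≡ x' ℕ.+ y' → x ≡ x' × y ≡ y'
    unique-⋅ _ _ _ _ (x , ax , refl) (y , by , refl) (x' , ax' , refl) (y' , by' , refl) e
      with unique x y x' y' ax by ax' by'
             (ℕ.*-cancelˡ-≡ (x ℕ.+ y) (x' ℕ.+ y') c
               (trans (ℕ.*-distribˡ-+ c x y) (trans e (sym (ℕ.*-distribˡ-+ c x' y')))))
    ... | refl , refl = refl , refl

sumL-map-⋅ : ∀ {A B : Set} c (F : B → SetN) (h : A → B) (G : A → SetN) →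
             (∀ x → F (h x) ≐ (c ⋅ G x)) → ∀ l → sumL (map F (map h l)) ≐ (c ⋅ sumL (map G l))
sumL-map-⋅ c F h G F∘h≐c⋅G []      = ≐-sym (⋅-｛0｝ c)
sumL-map-⋅ c F h G F∘h≐c⋅G (x ∷ l) =
  ≐-trans (+ˢ-cong (F∘h≐c⋅G x) (sumL-map-⋅ c F h G F∘h≐c⋅G l)) (≐-sym (⋅-distribˡ-+ˢ c))

fromList-map-* : ∀ c l → fromList (map (c ℕ.*_) l) ≐ (c ⋅ fromList l)
fromList-map-* c l _ = ∈-map⁻ (c ℕ.*_) , λ { (x , x∈l , refl) → ∈-map⁺ (c ℕ.*_) x∈l }

⨁-cong : ∀ {p} {f g : Fin p → SetN} → (∀ i → f i ≐ g i) → ⨁ f ≐ ⨁ g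
⨁-cong {ℕ.zero} f≐g = ≐-refl
⨁-cong {suc p}  f≐g = +ˢ-cong (f≐g Fin.zero) (⨁-cong (f≐g ∘ Fin.suc))

⨁-splitAt : ∀ p {q} (f : Fin (p ℕ.+ q) → SetN) →
            ⨁ f ≐ (⨁ (λ x → f (x ↑ˡ q)) +ˢ ⨁ (λ z → f (p ↑ʳ z)))
⨁-splitAt ℕ.zero  f = ≐-sym +ˢ-identityˡ
⨁-splitAt (suc p) f = ≐-trans (+ˢ-cong ≐-refl (⨁-splitAt p (f ∘ Fin.suc))) (≐-sym +ˢ-assoc)

⨁-punchIn : ∀ {p} (f : Fin (suc p) → SetN) k → ⨁ f ≐ (f k +ˢ ⨁ (f ∘ punchIn k))
⨁-punchIn f Fin.zero            = ≐-refl
⨁-punchIn {suc p} f (Fin.suc k) = ≐-trans (+ˢ-cong ≐-refl (⨁-punchIn (f ∘ Fin.suc) k)) +ˢ-leftComm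

⨁-⋅ : ∀ {p} c (f : Fin p → SetN) → (c ⋅ ⨁ f) ≐ ⨁ (λ i → c ⋅ f i)
⨁-⋅ {ℕ.zero} c f = ⋅-｛0｝ c
⨁-⋅ {suc p}  c f = ≐-trans (⋅-distribˡ-+ˢ c) (+ˢ-cong ≐-refl (⨁-⋅ c (f ∘ Fin.suc)))

prodFin-cong : ∀ {p} {f g : Fin p → ℕ} → (∀ i → f i ≡ g i) → prodFin f ≡ prodFin g
prodFin-cong {ℕ.zero} f≡g = refl
prodFin-cong {suc p}  f≡g = cong₂ ℕ._*_ (f≡g Fin.zero) (prodFin-cong (f≡g ∘ Fin.suc))

prodFin-splitAt : ∀ p {q} (f : Fin (p ℕ.+ q) → ℕ) →
                  prodFin f ≡ prodFin (λ x → f (x ↑ˡ q)) ℕ.* prodFin (λ z → f (p ↑ʳ z))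
prodFin-splitAt ℕ.zero  f = sym (ℕ.+-identityʳ _)
prodFin-splitAt (suc p) f =
  trans (cong (f Fin.zero ℕ.*_) (prodFin-splitAt p (f ∘ Fin.suc))) (sym (ℕ.*-assoc (f Fin.zero) _ _))

sumFinℚ-cong : ∀ {p} {f g : Fin p → ℚ} → (∀ i → f i ≡ g i) → sumFinℚ f ≡ sumFinℚ g
sumFinℚ-cong {ℕ.zero} f≡g = refl
sumFinℚ-cong {suc p}  f≡g = cong₂ _+_ (f≡g Fin.zero) (sumFinℚ-cong (f≡g ∘ Fin.suc))

sumFinℚ-splitAt : ∀ p {q} (f : Fin (p ℕ.+ q) → ℚ) →
                  sumFinℚ f ≡ sumFinℚ (λ x → f (x ↑ˡ q)) + sumFinℚ (λ z → f (p ↑ʳ z))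
sumFinℚ-splitAt ℕ.zero  f = sym (ℚ.+-identityˡ _)
sumFinℚ-splitAt (suc p) f =
  trans (cong (_+_ (f Fin.zero)) (sumFinℚ-splitAt p (f ∘ Fin.suc))) (sym (ℚ.+-assoc (f Fin.zero) _ _))

sumFinℚ-*ˡ : ∀ {p} c (f : Fin p → ℚ) → sumFinℚ (λ i → c * f i) ≡ c * sumFinℚ f
sumFinℚ-*ˡ {ℕ.zero} c f = sym (ℚ.*-zeroʳ c)
sumFinℚ-*ˡ {suc p}  c f =
  trans (cong (_+_ (c * f Fin.zero)) (sumFinℚ-*ˡ c (f ∘ Fin.suc))) (sym (ℚ.*-distribˡ-+ c _ _))

toℚᵘ-/ : ∀ i p .{{_ : NonZero p}} → toℚᵘ (i / p) ℚᵘ.≃ (i ℚᵘ./ p)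
toℚᵘ-/ i (suc p) = ℚ.toℚᵘ-fromℚᵘ (ℚᵘ.mkℚᵘ i p)

i*j/p*q≡i/p*j/q : ∀ i j p q .{{_ : NonZero p}} .{{_ : NonZero q}} →
                  ((i ℤ.* j) / (p ℕ.* q)) {{ℕ.m*n≢0 p q}} ≡ (i / p) * (j / q)
i*j/p*q≡i/p*j/q i j p@(suc _) q@(suc _) = ℚ.toℚᵘ-injective (begin
  toℚᵘ ((i ℤ.* j) / (p ℕ.* q))       ≈⟨ toℚᵘ-/ (i ℤ.* j) (p ℕ.* q) ⟩
  (i ℤ.* j) ℚᵘ./ (p ℕ.* q)           ≡⟨⟩
  (i ℚᵘ./ p) ℚᵘ.* (j ℚᵘ./ q)         ≈⟨ ℚᵘ.*-cong (toℚᵘ-/ i p) (toℚᵘ-/ j q) ⟨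
  toℚᵘ (i / p) ℚᵘ.* toℚᵘ (j / q)     ≈⟨ ℚ.toℚᵘ-homo-* (i / p) (j / q) ⟨
  toℚᵘ ((i / p) * (j / q))           ∎)
  where open SetoidReasoning ℚᵘ.≃-setoid

m*n/p*q≡m/p*n/q : ∀ m n p q .{{_ : NonZero p}} .{{_ : NonZero q}} →
                  (+ (m ℕ.* n) / (p ℕ.* q)) {{ℕ.m*n≢0 p q}} ≡ (+ m / p) * (+ n / q)
m*n/p*q≡m/p*n/q m n p q =
  trans (ℚ./-cong {{ℕ.m*n≢0 p q}} {{ℕ.m*n≢0 p q}} (ℤ.pos-* m n) refl) (i*j/p*q≡i/p*j/q (+ m) (+ n) p q)

c*x/p≡c/1*x/p : ∀ c x p .{{_ : NonZero p}} → + (c ℕ.* x) / p ≡ (+ c / 1) * (+ x / p)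
c*x/p≡c/1*x/p c x p@(suc _) =
  trans (ℚ./-cong {p₁ = + (c ℕ.* x)} refl (sym (ℕ.*-identityˡ p))) (m*n/p*q≡m/p*n/q c x 1 p)

sum-map-* : ∀ c l → sum (map (c ℕ.*_) l) ≡ c ℕ.* sum l
sum-map-* c []      = sym (ℕ.*-zeroʳ c)
sum-map-* c (x ∷ l) = trans (cong (c ℕ.* x ℕ.+_) (sum-map-* c l)) (sym (ℕ.*-distribˡ-+ c x (sum l)))

maxL-map-* : ∀ c l → maxL (map (c ℕ.*_) l) ≡ c ℕ.* maxL l
maxL-map-* c []      = sym (ℕ.*-zeroʳ c)
maxL-map-* c (x ∷ l) = trans (cong (c ℕ.* x ℕ.⊔_) (maxL-map-* c l)) (sym (ℕ.*-distribˡ-⊔ c x (maxL l)))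

c*[x-y]≡c*x-c*y : ∀ c x y → c * (x - y) ≡ c * x - c * y
c*[x-y]≡c*x-c*y c x y = trans (ℚ.*-distribˡ-+ c x (ℚ.- y)) (cong (_+_ (c * x)) (sym (ℚ.neg-distribʳ-* c y)))

-- Asym-e G h e is, definitionally, asymmetry (rem G e).
asymmetry : (R : List ℕ) .{{_ : NonZero (length R)}} → ℚ
asymmetry R = + (2 ℕ.* sum R) / length R - + maxL R / 1

asymmetry-map-* : ∀ c R .{{_ : NonZero (length R)}} .{{_ : NonZero (length (map (c ℕ.*_) R))}} →
                  asymmetry (map (c ℕ.*_) R) ≡ (+ c / 1) * asymmetry R
asymmetry-map-* c R = begin
  + (2 ℕ.* sum (map (c ℕ.*_) R)) / length (map (c ℕ.*_) R) - + maxL (map (c ℕ.*_) R) / 1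
    ≡⟨ cong₂ _-_ (ℚ./-cong (cong +_ 2*sum) (length-map (c ℕ.*_) R)) (ℚ./-cong (cong +_ (maxL-map-* c R)) refl) ⟩
  + (c ℕ.* (2 ℕ.* sum R)) / length R - + (c ℕ.* maxL R) / 1
    ≡⟨ cong₂ _-_ (c*x/p≡c/1*x/p c (2 ℕ.* sum R) (length R)) (c*x/p≡c/1*x/p c (maxL R) 1) ⟩
  c' * (+ (2 ℕ.* sum R) / length R) - c' * (+ maxL R / 1)
    ≡⟨ c*[x-y]≡c*x-c*y c' _ _ ⟨
  c' * asymmetry R
    ∎
  where
    open ≡-Reasoning
    c' : ℚ
    c' = + c / 1
    2*sum : 2 ℕ.* sum (map (c ℕ.*_) R) ≡ c ℕ.* (2 ℕ.* sum R)
    2*sum = trans (cong (2 ℕ.*_) (sum-map-* c R)) (x∙yz≈y∙xz 2 c (sum R))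

asymmetry-resp-map-* : ∀ c {R R'} .{{_ : NonZero (length R)}} .{{_ : NonZero (length R')}} →
                       R' ≡ map (c ℕ.*_) R → asymmetry R' ≡ (+ c / 1) * asymmetry R
asymmetry-resp-map-* c {R} refl = asymmetry-map-* c R

data SplitView (p q : ℕ) : Fin (p ℕ.+ q) → Set where
  left  : (x : Fin p) → SplitView p q (x ↑ˡ q)
  right : (z : Fin q) → SplitView p q (p ↑ʳ z)

splitView : ∀ p q i → SplitView p q i
splitView p q i with splitAt p i in eq
... | inj₁ x = subst (SplitView p q) (splitAt⁻¹-↑ˡ eq) (left x)
... | inj₂ z = subst (SplitView p q) (splitAt⁻¹-↑ʳ eq) (right z)

↑ˡ≢↑ʳ : ∀ {p q} (x : Fin p) (z : Fin q) → x ↑ˡ q ≢ p ↑ʳ z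
↑ˡ≢↑ʳ {p} {q} x z eq with trans (sym (splitAt-↑ˡ p x q)) (trans (cong (splitAt p) eq) (splitAt-↑ʳ p q z))
... | ()

-- Fin (suc p + q) is the pushout of Fin (suc p) and Fin (suc q) gluing k to rt; it is the node
-- set of compose, and copair is its universal property.
module Gluing {p q : ℕ} (k : Fin (suc p)) (rt : Fin (suc q)) where

  inl : Fin (suc p) → Fin (suc p ℕ.+ q)
  inl x = x ↑ˡ q

  inr : Fin (suc q) → Fin (suc p ℕ.+ q)
  inr = embedG' k rt

  inr-rt : inr rt ≡ inl k
  inr-rt with rt ≟ rt
  ... | yes _    = refl
  ... | no rt≢rt = ⊥-elim (rt≢rt refl)

  inr-punchIn : ∀ z → inr (punchIn rt z) ≡ suc p ↑ʳ z
  inr-punchIn z with rt ≟ punchIn rt z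
  ... | yes rt≡ = ⊥-elim (punchInᵢ≢i rt z (sym rt≡))
  ... | no _    = cong (suc p ↑ʳ_) (trans (punchOut-cong rt refl) (punchOut-punchIn rt))

  data GlueView : Fin (suc p ℕ.+ q) → Set where
    inl-view : ∀ x → GlueView (inl x)
    inr-view : ∀ y → y ≢ rt → GlueView (inr y)

  glueView : ∀ i → GlueView i
  glueView i with splitView (suc p) q i
  ... | left x  = inl-view x
  ... | right z = subst GlueView (inr-punchIn z) (inr-view (punchIn rt z) (punchInᵢ≢i rt z))

  inl-injective : ∀ {x x'} → inl x ≡ inl x' → x ≡ x'
  inl-injective = ↑ˡ-injective q _ _

  inr-injective : ∀ {y y'} → inr y ≡ inr y' → y ≡ y'
  inr-injective {y} {y'} eq with rt ≟ y | rt ≟ y'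
  ... | yes rt≡y | yes rt≡y' = trans (sym rt≡y) rt≡y'
  ... | yes _    | no rt≢y'  = ⊥-elim (↑ˡ≢↑ʳ k (punchOut rt≢y') eq)
  ... | no rt≢y  | yes _     = ⊥-elim (↑ˡ≢↑ʳ k (punchOut rt≢y) (sym eq))
  ... | no rt≢y  | no rt≢y'  = punchOut-injective rt≢y rt≢y' (↑ʳ-injective (suc p) _ _ eq)

  inr≡inl⇒≡rt : ∀ {x y} → inr y ≡ inl x → y ≡ rt
  inr≡inl⇒≡rt {x} {y} eq with rt ≟ y
  ... | yes rt≡y = sym rt≡y
  ... | no rt≢y  = ⊥-elim (↑ˡ≢↑ʳ x (punchOut rt≢y) (sym eq))

  copair : ∀ {a} {A : Set a} → (Fin (suc p) → A) → (Fin (suc q) → A) → Fin (suc p ℕ.+ q) → A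
  copair f g i = [ f , g ∘ punchIn rt ]′ (splitAt (suc p) i)

  module _ {a} {A : Set a} (f : Fin (suc p) → A) (g : Fin (suc q) → A) where

    copair-inl : ∀ x → copair f g (inl x) ≡ f x
    copair-inl x = cong [ f , g ∘ punchIn rt ]′ (splitAt-↑ˡ (suc p) x q)

    copair-↑ʳ : ∀ z → copair f g (suc p ↑ʳ z) ≡ g (punchIn rt z)
    copair-↑ʳ z = cong [ f , g ∘ punchIn rt ]′ (splitAt-↑ʳ (suc p) q z)

    copair-inr : ∀ {ℓ} {_∼_ : Rel A ℓ} → Reflexive _∼_ → f k ∼ g rt → ∀ y → copair f g (inr y) ∼ g y
    copair-inr {_∼_ = _∼_} ∼-refl fk∼grt y with rt ≟ y
    ... | yes refl = subst (_∼ g rt) (sym (copair-inl k)) fk∼grt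
    ... | no rt≢y  = subst (_∼ g y) (sym (trans (copair-↑ʳ (punchOut rt≢y)) (cong g (punchIn-punchOut rt≢y))))
                           ∼-refl

  copair-inr-≡ : ∀ {a} {A : Set a} (f : Fin (suc p) → A) g → f k ≡ g rt → ∀ y → copair f g (inr y) ≡ g y
  copair-inr-≡ f g = copair-inr f g {_∼_ = _≡_} refl

data Port : Set where
  input output : Port

ports : Port → (G : PreGraph) → Fin (m G) → List (Fin (suc (n G)))
ports input  = ins
ports output = outs

portSum : Port → (G : PreGraph) → Fin (m G) → SetN
portSum s G e = sumL (map (node G) (ports s G e))

Unique-map-++ : ∀ {A B : Set} {h : A → B} → (∀ {x y} → h x ≡ h y → x ≡ y) →
                ∀ {xs ys xs' ys'} → xs' ≡ map h xs → ys' ≡ map h ys →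
                Unique (xs ++ ys) → Unique (xs' ++ ys')
Unique-map-++ {h = h} h-inj {xs} {ys} refl refl u = subst Unique (map-++ h xs ys) (Unique.map⁺ h-inj u)

IsDirectSum-edge-⋅ : ∀ c .{{_ : NonZero c}} {O I R O' I' R'} →
                     O ≐ (c ⋅ O') → I ≐ (c ⋅ I') → R ≐ (c ⋅ R') →
                     IsDirectSum (O' +ˢ I') O' R' → IsDirectSum (O +ˢ I) O R
IsDirectSum-edge-⋅ c O≐ I≐ R≐ ds =
  IsDirectSum-resp (≐-sym (≐-trans (+ˢ-cong O≐ I≐) (≐-sym (⋅-distribˡ-+ˢ c)))) (≐-sym O≐) (≐-sym R≐)
                   (IsDirectSum-⋅ c ds)

module Composition (G G' : PreGraph) (k : Fin (suc (n G))) (a : ℕ) where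

  open Gluing k (root G') public

  C : PreGraph
  C = compose G k a G'

  node-inl : ∀ x → node C (inl x) ≡ r G' ⋅ node G x
  node-inl = copair-inl (λ x → r G' ⋅ node G x) (λ y → a ⋅ node G' y)

  node-↑ʳ : ∀ z → node C (suc (n G) ↑ʳ z) ≡ a ⋅ node G' (punchIn (root G') z)
  node-↑ʳ = copair-↑ʳ (λ x → r G' ⋅ node G x) (λ y → a ⋅ node G' y)

  ports-↑ˡ : ∀ s f → ports s C (f ↑ˡ m G') ≡ map inl (ports s G f)
  ports-↑ˡ input  f rewrite splitAt-↑ˡ (m G) f (m G') = refl
  ports-↑ˡ output f rewrite splitAt-↑ˡ (m G) f (m G') = refl

  ports-↑ʳ : ∀ s f → ports s C (m G ↑ʳ f) ≡ map inr (ports s G' f)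
  ports-↑ʳ input  f rewrite splitAt-↑ʳ (m G) (m G') f = refl
  ports-↑ʳ output f rewrite splitAt-↑ʳ (m G) (m G') f = refl

  rem-↑ˡ : ∀ f → rem C (f ↑ˡ m G') ≡ map (r G' ℕ.*_) (rem G f)
  rem-↑ˡ f rewrite splitAt-↑ˡ (m G) f (m G') = refl

  rem-↑ʳ : ∀ f → rem C (m G ↑ʳ f) ≡ map (a ℕ.*_) (rem G' f)
  rem-↑ʳ f rewrite splitAt-↑ʳ (m G) (m G') f = refl

  w-↑ˡ : ∀ f → w C (f ↑ˡ m G') ≡ w G f
  w-↑ˡ f = trans (cong length (rem-↑ˡ f)) (length-map _ (rem G f))

  w-↑ʳ : ∀ f → w C (m G ↑ʳ f) ≡ w G' f
  w-↑ʳ f = trans (cong length (rem-↑ʳ f)) (length-map _ (rem G' f))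

  ∈-ports-↑ˡ : ∀ {s f j} → j ∈ ports s C (f ↑ˡ m G') → ∃ λ x → x ∈ ports s G f × j ≡ inl x
  ∈-ports-↑ˡ {s} {f} j∈ = ∈-map⁻ inl (subst (_ ∈_) (ports-↑ˡ s f) j∈)

  ∈-ports-↑ʳ : ∀ {s f j} → j ∈ ports s C (m G ↑ʳ f) → ∃ λ y → y ∈ ports s G' f × j ≡ inr y
  ∈-ports-↑ʳ {s} {f} j∈ = ∈-map⁻ inr (subst (_ ∈_) (ports-↑ʳ s f) j∈)

  module ReductionGraph {{_ : NonZero a}} (k≐⟨a⟩ : node G k ≐ ⟨ a ⟩) (hG : IsRG G) (hG' : IsRG G') where

    instance
      r'≢0 : NonZero (r G')
      r'≢0 = r-pos hG'

    scaled-k : (r G' ⋅ node G k) ≐ ⟨ r G' ℕ.* a ⟩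
    scaled-k = ≐-trans (⋅-cong (r G') k≐⟨a⟩) (⋅-⟨⟩ (r G') a)

    scaled-root : (a ⋅ node G' (root G')) ≐ ⟨ r G' ℕ.* a ⟩
    scaled-root = begin
      a ⋅ node G' (root G')   ≈⟨ ⋅-cong a (root-node hG') ⟩
      a ⋅ ⟨ r G' ⟩            ≈⟨ ⋅-⟨⟩ a (r G') ⟩
      ⟨ a ℕ.* r G' ⟩          ≡⟨ cong ⟨_⟩ (ℕ.*-comm a (r G')) ⟩
      ⟨ r G' ℕ.* a ⟩          ∎
      where open ≐-Reasoning

    node-inr : ∀ y → node C (inr y) ≐ (a ⋅ node G' y)
    node-inr = copair-inr (λ x → r G' ⋅ node G x) (λ y → a ⋅ node G' y) {_∼_ = _≐_} ≐-refl
                          (≐-trans scaled-k (≐-sym scaled-root))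

    portSum-↑ˡ : ∀ s f → portSum s C (f ↑ˡ m G') ≐ (r G' ⋅ portSum s G f)
    portSum-↑ˡ s f rewrite ports-↑ˡ s f =
      sumL-map-⋅ (r G') (node C) inl (node G) (≐-reflexive ∘ node-inl) (ports s G f)

    portSum-↑ʳ : ∀ s f → portSum s C (m G ↑ʳ f) ≐ (a ⋅ portSum s G' f)
    portSum-↑ʳ s f rewrite ports-↑ʳ s f = sumL-map-⋅ a (node C) inr (node G') node-inr (ports s G' f)

    node-0-C : ∀ i → node C i 0
    node-0-C i with glueView i
    ... | inl-view x = subst (λ X → X 0) (sym (node-inl x)) (0 , node-0 hG x , sym (ℕ.*-zeroʳ (r G')))
    ... | inr-view y _ = proj₂ (node-inr y 0) (0 , node-0 hG' y , sym (ℕ.*-zeroʳ a))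

    edge-unique-C : ∀ e → Unique (outs C e ++ ins C e)
    edge-unique-C e with splitView (m G) (m G') e
    ... | left f  = Unique-map-++ inl-injective (ports-↑ˡ output f) (ports-↑ˡ input f) (edge-unique hG f)
    ... | right f = Unique-map-++ inr-injective (ports-↑ʳ output f) (ports-↑ʳ input f) (edge-unique hG' f)

    rem-unique-C : ∀ e → Unique (rem C e)
    rem-unique-C e with splitView (m G) (m G') e
    ... | left f  = subst Unique (sym (rem-↑ˡ f)) (Unique.map⁺ (ℕ.*-cancelˡ-≡ _ _ (r G')) (rem-unique hG f))
    ... | right f = subst Unique (sym (rem-↑ʳ f)) (Unique.map⁺ (ℕ.*-cancelˡ-≡ _ _ a) (rem-unique hG' f))

    edge-sum-C : ∀ e → IsDirectSum (OutSum C e +ˢ InSum C e) (OutSum C e) (fromList (rem C e))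
    edge-sum-C e with splitView (m G) (m G') e
    ... | left f  = IsDirectSum-edge-⋅ (r G') (portSum-↑ˡ output f) (portSum-↑ˡ input f)
                      (≐-trans (≐-reflexive (cong fromList (rem-↑ˡ f))) (fromList-map-* (r G') (rem G f)))
                      (edge-sum hG f)
    ... | right f = IsDirectSum-edge-⋅ a (portSum-↑ʳ output f) (portSum-↑ʳ input f)
                      (≐-trans (≐-reflexive (cong fromList (rem-↑ʳ f))) (fromList-map-* a (rem G' f)))
                      (edge-sum hG' f)

    inl∈ins-↑ˡ : ∀ {x f} → inl x ∈ ins C (f ↑ˡ m G') → x ∈ ins G f
    inl∈ins-↑ˡ {f = f} x∈ with ∈-ports-↑ˡ {input} x∈
    ... | x' , x'∈ , eq = subst (_∈ ins G f) (sym (inl-injective eq)) x'∈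

    inr∈ins-↑ʳ : ∀ {y f} → inr y ∈ ins C (m G ↑ʳ f) → y ∈ ins G' f
    inr∈ins-↑ʳ {f = f} y∈ with ∈-ports-↑ʳ {input} y∈
    ... | y' , y'∈ , eq = subst (_∈ ins G' f) (sym (inr-injective eq)) y'∈

    -- The root of G' is glued to inl k but is the input of no edge of G'.
    inl∉ins-↑ʳ : ∀ {x f} → inl x ∉ ins C (m G ↑ʳ f)
    inl∉ins-↑ʳ {f = f} x∈ with ∈-ports-↑ʳ {input} x∈
    ... | y , y∈ , eq = root-no-input hG' f (subst (_∈ ins G' f) (inr≡inl⇒≡rt (sym eq)) y∈)

    inr∉ins-↑ˡ : ∀ {y f} → y ≢ root G' → inr y ∉ ins C (f ↑ˡ m G')
    inr∉ins-↑ˡ y≢rt y∈ with ∈-ports-↑ˡ {input} y∈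
    ... | _ , _ , eq = y≢rt (inr≡inl⇒≡rt eq)

    root-no-input-C : ∀ e → root C ∉ ins C e
    root-no-input-C e with splitView (m G) (m G') e
    ... | left f  = root-no-input hG f ∘ inl∈ins-↑ˡ
    ... | right f = inl∉ins-↑ʳ

    nonroot-input-C : ∀ j → j ≢ root C →
                      Σ (Fin (m C)) λ e → j ∈ ins C e × (∀ e' → j ∈ ins C e' → e' ≡ e)
    nonroot-input-C j j≢root with glueView j
    ... | inl-view x with nonroot-input hG x (j≢root ∘ cong inl)
    ...   | f , x∈ , unique =
      f ↑ˡ m G' , subst (_ ∈_) (sym (ports-↑ˡ input f)) (∈-map⁺ inl x∈) , unique-C
      where
        unique-C : ∀ e' → inl x ∈ ins C e' → e' ≡ f ↑ˡ m G'
        unique-C e' x∈' with splitView (m G) (m G') e'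
        ... | left f'  = cong (_↑ˡ m G') (unique f' (inl∈ins-↑ˡ x∈'))
        ... | right f' = ⊥-elim (inl∉ins-↑ʳ x∈')
    nonroot-input-C j j≢root | inr-view y y≢rt with nonroot-input hG' y y≢rt
    ...   | f , y∈ , unique =
      m G ↑ʳ f , subst (_ ∈_) (sym (ports-↑ʳ input f)) (∈-map⁺ inr y∈) , unique-C
      where
        unique-C : ∀ e' → inr y ∈ ins C e' → e' ≡ m G ↑ʳ f
        unique-C e' y∈' with splitView (m G) (m G') e'
        ... | left f'  = ⊥-elim (inr∉ins-↑ˡ y≢rt y∈')
        ... | right f' = cong (m G ↑ʳ_) (unique f' (inr∈ins-↑ʳ y∈'))

    arrow-from-inl : ∀ {x j} → Arrow C (inl x) j → ∃ λ x' → j ≡ inl x' × Arrow G x x'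
    arrow-from-inl (e , x∈ , j∈) with splitView (m G) (m G') e
    ... | left f with ∈-ports-↑ˡ {output} j∈
    ...   | x' , x'∈ , j≡ = x' , j≡ , f , inl∈ins-↑ˡ x∈ , x'∈
    arrow-from-inl (e , x∈ , j∈) | right f = ⊥-elim (inl∉ins-↑ʳ x∈)

    arrow-from-inr : ∀ {y j} → y ≢ root G' → Arrow C (inr y) j → ∃ λ y' → j ≡ inr y' × Arrow G' y y'
    arrow-from-inr y≢rt (e , y∈ , j∈) with splitView (m G) (m G') e
    ... | left f  = ⊥-elim (inr∉ins-↑ˡ y≢rt y∈)
    ... | right f with ∈-ports-↑ʳ {output} j∈
    ...   | y' , y'∈ , j≡ = y' , j≡ , f , inr∈ins-↑ʳ y∈ , y'∈

    path-from-inl : ∀ {x j} → TransClosure (Arrow C) (inl x) j →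
                    ∃ λ x' → j ≡ inl x' × TransClosure (Arrow G) x x'
    path-from-inl [ step ] with arrow-from-inl step
    ... | x' , j≡ , arrow = x' , j≡ , [ arrow ]
    path-from-inl (step ∷ steps) with arrow-from-inl step
    ... | x₁ , refl , arrow with path-from-inl steps
    ...   | x' , j≡ , path = x' , j≡ , arrow ∷ path

    -- A path that leaves the image of G' \ {root G'} enters inl and never comes back.
    path-between-inr : ∀ {y y'} → y ≢ root G' → y' ≢ root G' →
                       TransClosure (Arrow C) (inr y) (inr y') → TransClosure (Arrow G') y y'
    path-between-inr y≢rt y'≢rt [ step ] with arrow-from-inr y≢rt step
    ... | _ , eq , arrow = [ subst (Arrow G' _) (sym (inr-injective eq)) arrow ]
    path-between-inr {y} {y'} y≢rt y'≢rt (step ∷ steps) with arrow-from-inr y≢rt step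
    ... | y₁ , refl , arrow = continue (root G' ≟ y₁) steps
      where
        continue : Dec (root G' ≡ y₁) → TransClosure (Arrow C) (inr y₁) (inr y') →
                   TransClosure (Arrow G') y y'
        continue (no rt≢y₁) rest = arrow ∷ path-between-inr (rt≢y₁ ∘ sym) y'≢rt rest
        continue (yes refl) rest with path-from-inl (subst (λ i → TransClosure (Arrow C) i (inr y')) inr-rt rest)
        ... | _ , eq , _ = ⊥-elim (y'≢rt (inr≡inl⇒≡rt eq))

    acyclic-C : ∀ i → ¬ TransClosure (Arrow C) i i
    acyclic-C i cycle with glueView i
    ... | inl-view x with path-from-inl cycle
    ...   | x' , eq , path = acyclic hG x (subst (TransClosure (Arrow G) x) (sym (inl-injective eq)) path)
    acyclic-C i cycle | inr-view y y≢rt = acyclic hG' y (path-between-inr y≢rt y≢rt cycle)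

    compose-isRG : IsRG C
    compose-isRG = record
      { node-0        = node-0-C
      ; edge-unique   = edge-unique-C
      ; rem-unique    = rem-unique-C
      ; edge-sum      = edge-sum-C
      ; acyclic       = acyclic-C
      ; root-no-input = root-no-input-C
      ; nonroot-input = nonroot-input-C
      ; r-pos         = ℕ.m*n≢0 (r G') (r G) {{r-pos hG'}} {{r-pos hG}}
      ; root-node     = ≐-trans (≐-reflexive (node-inl (root G)))
                                (≐-trans (⋅-cong (r G') (root-node hG)) (⋅-⟨⟩ (r G') (r G)))
      }

    S-compose : S C ≐ ((r G' ⋅ S G) +ˢ (a ⋅ S G'))
    S-compose = begin
      ⨁ (node C)
        ≈⟨ ⨁-splitAt (suc (n G)) (node C) ⟩
      ⨁ (λ x → node C (inl x)) +ˢ ⨁ (λ z → node C (suc (n G) ↑ʳ z))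
        ≈⟨ +ˢ-cong (⨁-cong (≐-reflexive ∘ node-inl)) (⨁-cong (≐-reflexive ∘ node-↑ʳ)) ⟩
      ⨁ G-part +ˢ ⨁ G'-part
        ≈⟨ +ˢ-cong (+ˢ-absorbʳ G-part≐ (⟨⟩-+ˢ-idem (r G' ℕ.* a))) ≐-refl ⟨
      (⨁ G-part +ˢ ⟨ r G' ℕ.* a ⟩) +ˢ ⨁ G'-part
        ≈⟨ +ˢ-assoc ⟩
      ⨁ G-part +ˢ (⟨ r G' ℕ.* a ⟩ +ˢ ⨁ G'-part)
        ≈⟨ +ˢ-cong (⨁-⋅ (r G') (node G)) (+ˢ-cong scaled-root (⨁-⋅ a (node G' ∘ punchIn (root G')))) ⟨
      (r G' ⋅ S G) +ˢ ((a ⋅ node G' (root G')) +ˢ (a ⋅ ⨁ (node G' ∘ punchIn (root G'))))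
        ≈⟨ +ˢ-cong ≐-refl (≐-trans (⋅-cong a (⨁-punchIn (node G') (root G'))) (⋅-distribˡ-+ˢ a)) ⟨
      (r G' ⋅ S G) +ˢ (a ⋅ S G')
        ∎
      where
        open ≐-Reasoning
        G-part : Fin (suc (n G)) → SetN
        G-part x = r G' ⋅ node G x
        G'-part : Fin (n G') → SetN
        G'-part z = a ⋅ node G' (punchIn (root G') z)
        G-part≐ : ⨁ G-part ≐ (⟨ r G' ℕ.* a ⟩ +ˢ ⨁ (G-part ∘ punchIn k))
        G-part≐ = ≐-trans (⨁-punchIn G-part k) (+ˢ-cong scaled-k ≐-refl)

    private
      instance
        ∏wG≢0 : NonZero (prodFin (w G))
        ∏wG≢0 = prod-nonZero (w G) (w-nonZero hG)
        ∏wG'≢0 : NonZero (prodFin (w G'))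
        ∏wG'≢0 = prod-nonZero (w G') (w-nonZero hG')

    Bal-compose : Bal C compose-isRG ≡ Bal G hG * Bal G' hG'
    Bal-compose = trans (ℚ./-cong {{prod-nonZero (w C) (w-nonZero compose-isRG)}}
                                  {{ℕ.m*n≢0 (prodFin (w G)) (prodFin (w G'))}}
                                  (cong +_ (ℕ.*-comm (r G') (r G))) ∏w-compose)
                        (m*n/p*q≡m/p*n/q (r G) (r G') (prodFin (w G)) (prodFin (w G')))
      where
        ∏w-compose : prodFin (w C) ≡ prodFin (w G) ℕ.* prodFin (w G')
        ∏w-compose = trans (prodFin-splitAt (m G) (w C)) (cong₂ ℕ._*_ (prodFin-cong w-↑ˡ) (prodFin-cong w-↑ʳ))

    Asym-compose : Asym C compose-isRG ≡ (+ r G' / 1) * Asym G hG + (+ a / 1) * Asym G' hG'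
    Asym-compose = begin
      Asym C compose-isRG
        ≡⟨ sumFinℚ-splitAt (m G) (Asym-e C compose-isRG) ⟩
      sumFinℚ (λ f → Asym-e C compose-isRG (f ↑ˡ m G')) + sumFinℚ (λ f → Asym-e C compose-isRG (m G ↑ʳ f))
        ≡⟨ cong₂ _+_ (sumFinℚ-cong Asym-e-↑ˡ) (sumFinℚ-cong Asym-e-↑ʳ) ⟩
      sumFinℚ (λ f → (+ r G' / 1) * Asym-e G hG f) + sumFinℚ (λ f → (+ a / 1) * Asym-e G' hG' f)
        ≡⟨ cong₂ _+_ (sumFinℚ-*ˡ (+ r G' / 1) (Asym-e G hG)) (sumFinℚ-*ˡ (+ a / 1) (Asym-e G' hG')) ⟩
      (+ r G' / 1) * Asym G hG + (+ a / 1) * Asym G' hG'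
        ∎
      where
        open ≡-Reasoning
        Asym-e-↑ˡ : ∀ f → Asym-e C compose-isRG (f ↑ˡ m G') ≡ (+ r G' / 1) * Asym-e G hG f
        Asym-e-↑ˡ f = asymmetry-resp-map-* (r G') {{w-nonZero hG f}} {{w-nonZero compose-isRG (f ↑ˡ m G')}}
                                           (rem-↑ˡ f)
        Asym-e-↑ʳ : ∀ f → Asym-e C compose-isRG (m G ↑ʳ f) ≡ (+ a / 1) * Asym-e G' hG' f
        Asym-e-↑ʳ f = asymmetry-resp-map-* a {{w-nonZero hG' f}} {{w-nonZero compose-isRG (m G ↑ʳ f)}}
                                           (rem-↑ʳ f)

    compose-symmetric : Symmetric G hG → Symmetric G' hG' → Symmetric C compose-isRG
    compose-symmetric AG≡0 AG'≡0 = begin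
      Asym C compose-isRG
        ≡⟨ Asym-compose ⟩
      (+ r G' / 1) * Asym G hG + (+ a / 1) * Asym G' hG'
        ≡⟨ cong₂ (λ u v → (+ r G' / 1) * u + (+ a / 1) * v) AG≡0 AG'≡0 ⟩
      (+ r G' / 1) * 0ℚ + (+ a / 1) * 0ℚ
        ≡⟨ cong₂ _+_ (ℚ.*-zeroʳ (+ r G' / 1)) (ℚ.*-zeroʳ (+ a / 1)) ⟩
      0ℚ
        ∎
      where open ≡-Reasoning

module RootComposition (G G' : PreGraph) (hG : IsRG G) (hG' : IsRG G') where
  open Composition G G' (root G) (r G) public
  open ReductionGraph {{r-pos hG}} (root-node hG) hG hG' public

mk≅ : ∀ {G H} (ν : Fin (suc (n G)) ↔ Fin (suc (n H))) (ε : Fin (m G) ↔ Fin (m H)) →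
      (∀ i → node G i ≐ node H (Inverse.to ν i)) →
      (∀ s e → map (Inverse.to ν) (ports s G e) ≡ ports s H (Inverse.to ε e)) →
      (∀ e → rem G e ≡ rem H (Inverse.to ε e)) →
      Inverse.to ν (root G) ≡ root H → r G ≡ r H → G ≅ H
mk≅ ν ε node≐ ports≡ rem≡ root≡ r≡ = record
  { nodeIso  = ν
  ; edgeIso  = ε
  ; node-iso = node≐
  ; ins-iso  = ↭-reflexive ∘ ports≡ input
  ; outs-iso = ↭-reflexive ∘ ports≡ output
  ; rem-iso  = ↭-reflexive ∘ rem≡
  ; root-iso = root≡
  ; r-iso    = r≡
  }

map-map : ∀ {A B C : Set} {f : B → C} {g : A → B} {h : A → C} → (∀ x → f (g x) ≡ h x) →
          ∀ l → map f (map g l) ≡ map h l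
map-map f∘g≗h l = trans (sym (map-∘ l)) (map-cong f∘g≗h l)

map-*-map-* : ∀ c d l → map (c ℕ.*_) (map (d ℕ.*_) l) ≡ map ((c ℕ.* d) ℕ.*_) l
map-*-map-* c d = map-map (λ x → sym (ℕ.*-assoc c d x))

+-comm↔ : ∀ p q → Fin (p ℕ.+ q) ↔ Fin (q ℕ.+ p)
+-comm↔ p q = ↔-trans (+↔⊎ {p} {q}) (↔-trans (⊎-comm _ _) (↔-sym (+↔⊎ {q} {p})))

+-comm↔-↑ˡ : ∀ p q (f : Fin p) → Inverse.to (+-comm↔ p q) (f ↑ˡ q) ≡ q ↑ʳ f
+-comm↔-↑ˡ p q f rewrite splitAt-↑ˡ p f q = refl

+-comm↔-↑ʳ : ∀ p q (f : Fin q) → Inverse.to (+-comm↔ p q) (p ↑ʳ f) ≡ f ↑ˡ p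
+-comm↔-↑ʳ p q f rewrite splitAt-↑ʳ p q f = refl

+-assoc↔ : ∀ p q r → Fin ((p ℕ.+ q) ℕ.+ r) ↔ Fin (p ℕ.+ (q ℕ.+ r))
+-assoc↔ p q r =
  ↔-trans (+↔⊎ {p ℕ.+ q} {r}) (↔-trans (+↔⊎ {p} {q} ⊎-↔ ↔-refl) (↔-trans (⊎-assoc 0ℓ _ _ _)
    (↔-trans (↔-refl ⊎-↔ ↔-sym (+↔⊎ {q} {r})) (↔-sym (+↔⊎ {p} {q ℕ.+ r})))))

+-assoc↔-↑ˡ↑ˡ : ∀ p q r (f : Fin p) → Inverse.to (+-assoc↔ p q r) ((f ↑ˡ q) ↑ˡ r) ≡ f ↑ˡ (q ℕ.+ r)
+-assoc↔-↑ˡ↑ˡ p q r f rewrite splitAt-↑ˡ (p ℕ.+ q) (f ↑ˡ q) r | splitAt-↑ˡ p f q = refl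

+-assoc↔-↑ʳ↑ˡ : ∀ p q r (f : Fin q) → Inverse.to (+-assoc↔ p q r) ((p ↑ʳ f) ↑ˡ r) ≡ p ↑ʳ (f ↑ˡ r)
+-assoc↔-↑ʳ↑ˡ p q r f rewrite splitAt-↑ˡ (p ℕ.+ q) (p ↑ʳ f) r | splitAt-↑ʳ p q f = refl

+-assoc↔-↑ʳ : ∀ p q r (f : Fin r) → Inverse.to (+-assoc↔ p q r) ((p ℕ.+ q) ↑ʳ f) ≡ p ↑ʳ (q ↑ʳ f)
+-assoc↔-↑ʳ p q r f rewrite splitAt-↑ʳ (p ℕ.+ q) r f = refl

module Commutativity (G G' : PreGraph) (hG : IsRG G) (hG' : IsRG G') where

  module P = RootComposition G G' hG hG'
  module Q = RootComposition G' G hG' hG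

  to : Fin (suc (n (G ∘ʳ G'))) → Fin (suc (n (G' ∘ʳ G)))
  to = P.copair Q.inr Q.inl

  from : Fin (suc (n (G' ∘ʳ G))) → Fin (suc (n (G ∘ʳ G')))
  from = Q.copair P.inr P.inl

  to-inl : ∀ x → to (P.inl x) ≡ Q.inr x
  to-inl = P.copair-inl Q.inr Q.inl

  to-inr : ∀ y → to (P.inr y) ≡ Q.inl y
  to-inr = P.copair-inr-≡ Q.inr Q.inl Q.inr-rt

  from-inl : ∀ y → from (Q.inl y) ≡ P.inr y
  from-inl = Q.copair-inl P.inr P.inl

  from-inr : ∀ x → from (Q.inr x) ≡ P.inl x
  from-inr = Q.copair-inr-≡ P.inr P.inl P.inr-rt

  from-to : ∀ i → from (to i) ≡ i
  from-to i with P.glueView i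
  ... | P.inl-view x   = trans (cong from (to-inl x)) (from-inr x)
  ... | P.inr-view y _ = trans (cong from (to-inr y)) (from-inl y)

  to-from : ∀ i → to (from i) ≡ i
  to-from i with Q.glueView i
  ... | Q.inl-view y   = trans (cong to (from-inl y)) (to-inr y)
  ... | Q.inr-view x _ = trans (cong to (from-inr x)) (to-inl x)

  edges : Fin (m (G ∘ʳ G')) ↔ Fin (m (G' ∘ʳ G))
  edges = +-comm↔ (m G) (m G')

  node≐ : ∀ i → node P.C i ≐ node Q.C (to i)
  node≐ i with P.glueView i
  ... | P.inl-view x   = ≐-trans (≐-reflexive (P.node-inl x))
                                 (≐-sym (≐-trans (≐-reflexive (cong (node Q.C) (to-inl x))) (Q.node-inr x)))
  ... | P.inr-view y _ = ≐-trans (P.node-inr y)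
                                 (≐-sym (≐-reflexive (trans (cong (node Q.C) (to-inr y)) (Q.node-inl y))))

  ports≡ : ∀ s e → map to (ports s P.C e) ≡ ports s Q.C (Inverse.to edges e)
  ports≡ s e with splitView (m G) (m G') e
  ... | left f  = begin
    map to (ports s P.C (f ↑ˡ m G'))      ≡⟨ cong (map to) (P.ports-↑ˡ s f) ⟩
    map to (map P.inl (ports s G f))      ≡⟨ map-map to-inl (ports s G f) ⟩
    map Q.inr (ports s G f)               ≡⟨ Q.ports-↑ʳ s f ⟨
    ports s Q.C (m G' ↑ʳ f)               ≡⟨ cong (ports s Q.C) (+-comm↔-↑ˡ (m G) (m G') f) ⟨
    ports s Q.C (Inverse.to edges (f ↑ˡ m G')) ∎
    where open ≡-Reasoning
  ... | right f = begin
    map to (ports s P.C (m G ↑ʳ f))       ≡⟨ cong (map to) (P.ports-↑ʳ s f) ⟩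
    map to (map P.inr (ports s G' f))     ≡⟨ map-map to-inr (ports s G' f) ⟩
    map Q.inl (ports s G' f)              ≡⟨ Q.ports-↑ˡ s f ⟨
    ports s Q.C (f ↑ˡ m G)                ≡⟨ cong (ports s Q.C) (+-comm↔-↑ʳ (m G) (m G') f) ⟨
    ports s Q.C (Inverse.to edges (m G ↑ʳ f)) ∎
    where open ≡-Reasoning

  rem≡ : ∀ e → rem P.C e ≡ rem Q.C (Inverse.to edges e)
  rem≡ e with splitView (m G) (m G') e
  ... | left f  = trans (P.rem-↑ˡ f) (sym (trans (cong (rem Q.C) (+-comm↔-↑ˡ (m G) (m G') f)) (Q.rem-↑ʳ f)))
  ... | right f = trans (P.rem-↑ʳ f) (sym (trans (cong (rem Q.C) (+-comm↔-↑ʳ (m G) (m G') f)) (Q.rem-↑ˡ f)))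

  ∘ʳ-comm : (G ∘ʳ G') ≅ (G' ∘ʳ G)
  ∘ʳ-comm = mk≅ (mk↔ₛ′ to from to-from from-to) edges node≐ ports≡ rem≡
                (trans (to-inl (root G)) Q.inr-rt) (ℕ.*-comm (r G') (r G))

module Associativity (G G' G'' : PreGraph) (hG : IsRG G) (hG' : IsRG G') (hG'' : IsRG G'') where

  module P = RootComposition G G' hG hG'
  module Q = RootComposition G' G'' hG' hG''
  module X = RootComposition (G ∘ʳ G') G'' P.compose-isRG hG''
  module Y = RootComposition G (G' ∘ʳ G'') hG Q.compose-isRG

  to-P : Fin (suc (n (G ∘ʳ G'))) → Fin (suc (n Y.C))
  to-P = P.copair Y.inl (Y.inr ∘ Q.inl)

  to : Fin (suc (n X.C)) → Fin (suc (n Y.C))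
  to = X.copair to-P (Y.inr ∘ Q.inr)

  from-Q : Fin (suc (n (G' ∘ʳ G''))) → Fin (suc (n X.C))
  from-Q = Q.copair (X.inl ∘ P.inr) X.inr

  from : Fin (suc (n Y.C)) → Fin (suc (n X.C))
  from = Y.copair (X.inl ∘ P.inl) from-Q

  to-G : ∀ x → to (X.inl (P.inl x)) ≡ Y.inl x
  to-G x = trans (X.copair-inl to-P (Y.inr ∘ Q.inr) (P.inl x)) (P.copair-inl Y.inl (Y.inr ∘ Q.inl) x)

  to-G' : ∀ y → to (X.inl (P.inr y)) ≡ Y.inr (Q.inl y)
  to-G' y = trans (X.copair-inl to-P (Y.inr ∘ Q.inr) (P.inr y)) (P.copair-inr-≡ Y.inl (Y.inr ∘ Q.inl) (sym Y.inr-rt) y)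

  to-G'' : ∀ z → to (X.inr z) ≡ Y.inr (Q.inr z)
  to-G'' = X.copair-inr-≡ to-P (Y.inr ∘ Q.inr)
             (trans (P.copair-inl Y.inl (Y.inr ∘ Q.inl) (root G)) (sym (trans (cong Y.inr Q.inr-rt) Y.inr-rt)))

  from-G : ∀ x → from (Y.inl x) ≡ X.inl (P.inl x)
  from-G = Y.copair-inl (X.inl ∘ P.inl) from-Q

  from-Q-part : ∀ q → from (Y.inr q) ≡ from-Q q
  from-Q-part = Y.copair-inr-≡ (X.inl ∘ P.inl) from-Q
                  (sym (trans (Q.copair-inl (X.inl ∘ P.inr) X.inr (root G')) (cong X.inl P.inr-rt)))

  from-G' : ∀ y → from (Y.inr (Q.inl y)) ≡ X.inl (P.inr y)
  from-G' y = trans (from-Q-part (Q.inl y)) (Q.copair-inl (X.inl ∘ P.inr) X.inr y)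

  from-G'' : ∀ z → from (Y.inr (Q.inr z)) ≡ X.inr z
  from-G'' z = trans (from-Q-part (Q.inr z))
                     (Q.copair-inr-≡ (X.inl ∘ P.inr) X.inr (trans (cong X.inl P.inr-rt) (sym X.inr-rt)) z)

  from-to : ∀ i → from (to i) ≡ i
  from-to i with X.glueView i
  ... | X.inr-view z _ = trans (cong from (to-G'' z)) (from-G'' z)
  ... | X.inl-view p with P.glueView p
  ...   | P.inl-view x   = trans (cong from (to-G x)) (from-G x)
  ...   | P.inr-view y _ = trans (cong from (to-G' y)) (from-G' y)

  to-from : ∀ i → to (from i) ≡ i
  to-from i with Y.glueView i
  ... | Y.inl-view x = trans (cong to (from-G x)) (to-G x)
  ... | Y.inr-view q _ with Q.glueView q
  ...   | Q.inl-view y   = trans (cong to (from-G' y)) (to-G' y)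
  ...   | Q.inr-view z _ = trans (cong to (from-G'' z)) (to-G'' z)

  node≐ : ∀ i → node X.C i ≐ node Y.C (to i)
  node≐ i with X.glueView i
  ... | X.inr-view z _ = begin
      node X.C (X.inr z)              ≈⟨ X.node-inr z ⟩
      (r G' ℕ.* r G) ⋅ node G'' z     ≡⟨ cong (_⋅ node G'' z) (ℕ.*-comm (r G') (r G)) ⟩
      (r G ℕ.* r G') ⋅ node G'' z     ≈⟨ ⋅-assoc (r G) (r G') ⟨
      r G ⋅ (r G' ⋅ node G'' z)       ≈⟨ ⋅-cong (r G) (Q.node-inr z) ⟨
      r G ⋅ node Q.C (Q.inr z)        ≈⟨ Y.node-inr (Q.inr z) ⟨
      node Y.C (Y.inr (Q.inr z))      ≡⟨ cong (node Y.C) (to-G'' z) ⟨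
      node Y.C (to (X.inr z))         ∎
    where open ≐-Reasoning
  ... | X.inl-view p with P.glueView p
  ...   | P.inl-view x = begin
      node X.C (X.inl (P.inl x))      ≡⟨ X.node-inl (P.inl x) ⟩
      r G'' ⋅ node P.C (P.inl x)      ≡⟨ cong (r G'' ⋅_) (P.node-inl x) ⟩
      r G'' ⋅ (r G' ⋅ node G x)       ≈⟨ ⋅-assoc (r G'') (r G') ⟩
      (r G'' ℕ.* r G') ⋅ node G x     ≡⟨ Y.node-inl x ⟨
      node Y.C (Y.inl x)              ≡⟨ cong (node Y.C) (to-G x) ⟨
      node Y.C (to (X.inl (P.inl x))) ∎
    where open ≐-Reasoning
  ...   | P.inr-view y _ = begin
      node X.C (X.inl (P.inr y))      ≡⟨ X.node-inl (P.inr y) ⟩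
      r G'' ⋅ node P.C (P.inr y)      ≈⟨ ⋅-cong (r G'') (P.node-inr y) ⟩
      r G'' ⋅ (r G ⋅ node G' y)       ≈⟨ ⋅-comm (r G'') (r G) ⟩
      r G ⋅ (r G'' ⋅ node G' y)       ≡⟨ cong (r G ⋅_) (Q.node-inl y) ⟨
      r G ⋅ node Q.C (Q.inl y)        ≈⟨ Y.node-inr (Q.inl y) ⟨
      node Y.C (Y.inr (Q.inl y))      ≡⟨ cong (node Y.C) (to-G' y) ⟨
      node Y.C (to (X.inl (P.inr y))) ∎
    where open ≐-Reasoning

  edges : Fin (m X.C) ↔ Fin (m Y.C)
  edges = +-assoc↔ (m G) (m G') (m G'')

  ports≡ : ∀ s e → map to (ports s X.C e) ≡ ports s Y.C (Inverse.to edges e)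
  ports≡ s e with splitView (m G ℕ.+ m G') (m G'') e
  ... | right f = begin
    map to (ports s X.C ((m G ℕ.+ m G') ↑ʳ f))    ≡⟨ cong (map to) (X.ports-↑ʳ s f) ⟩
    map to (map X.inr (ports s G'' f))            ≡⟨ map-map to-G'' (ports s G'' f) ⟩
    map (Y.inr ∘ Q.inr) (ports s G'' f)           ≡⟨ map-map (λ _ → refl) (ports s G'' f) ⟨
    map Y.inr (map Q.inr (ports s G'' f))         ≡⟨ cong (map Y.inr) (Q.ports-↑ʳ s f) ⟨
    map Y.inr (ports s Q.C (m G' ↑ʳ f))           ≡⟨ Y.ports-↑ʳ s (m G' ↑ʳ f) ⟨
    ports s Y.C (m G ↑ʳ (m G' ↑ʳ f))              ≡⟨ cong (ports s Y.C) (+-assoc↔-↑ʳ (m G) (m G') (m G'') f) ⟨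
    ports s Y.C (Inverse.to edges ((m G ℕ.+ m G') ↑ʳ f)) ∎
    where open ≡-Reasoning
  ... | left e' with splitView (m G) (m G') e'
  ...   | left f = begin
    map to (ports s X.C ((f ↑ˡ m G') ↑ˡ m G''))   ≡⟨ cong (map to) (X.ports-↑ˡ s (f ↑ˡ m G')) ⟩
    map to (map X.inl (ports s P.C (f ↑ˡ m G')))  ≡⟨ cong (map to ∘ map X.inl) (P.ports-↑ˡ s f) ⟩
    map to (map X.inl (map P.inl (ports s G f)))  ≡⟨ map-map (λ _ → refl) (map P.inl (ports s G f)) ⟩
    map (to ∘ X.inl) (map P.inl (ports s G f))    ≡⟨ map-map to-G (ports s G f) ⟩
    map Y.inl (ports s G f)                       ≡⟨ Y.ports-↑ˡ s f ⟨
    ports s Y.C (f ↑ˡ (m G' ℕ.+ m G''))           ≡⟨ cong (ports s Y.C) (+-assoc↔-↑ˡ↑ˡ (m G) (m G') (m G'') f) ⟨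
    ports s Y.C (Inverse.to edges ((f ↑ˡ m G') ↑ˡ m G'')) ∎
    where open ≡-Reasoning
  ...   | right f = begin
    map to (ports s X.C ((m G ↑ʳ f) ↑ˡ m G''))    ≡⟨ cong (map to) (X.ports-↑ˡ s (m G ↑ʳ f)) ⟩
    map to (map X.inl (ports s P.C (m G ↑ʳ f)))   ≡⟨ cong (map to ∘ map X.inl) (P.ports-↑ʳ s f) ⟩
    map to (map X.inl (map P.inr (ports s G' f))) ≡⟨ map-map (λ _ → refl) (map P.inr (ports s G' f)) ⟩
    map (to ∘ X.inl) (map P.inr (ports s G' f))   ≡⟨ map-map to-G' (ports s G' f) ⟩
    map (Y.inr ∘ Q.inl) (ports s G' f)            ≡⟨ map-map (λ _ → refl) (ports s G' f) ⟨
    map Y.inr (map Q.inl (ports s G' f))          ≡⟨ cong (map Y.inr) (Q.ports-↑ˡ s f) ⟨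
    map Y.inr (ports s Q.C (f ↑ˡ m G''))          ≡⟨ Y.ports-↑ʳ s (f ↑ˡ m G'') ⟨
    ports s Y.C (m G ↑ʳ (f ↑ˡ m G''))             ≡⟨ cong (ports s Y.C) (+-assoc↔-↑ʳ↑ˡ (m G) (m G') (m G'') f) ⟨
    ports s Y.C (Inverse.to edges ((m G ↑ʳ f) ↑ˡ m G'')) ∎
    where open ≡-Reasoning

  rem≡ : ∀ e → rem X.C e ≡ rem Y.C (Inverse.to edges e)
  rem≡ e with splitView (m G ℕ.+ m G') (m G'') e
  ... | right f = begin
    rem X.C ((m G ℕ.+ m G') ↑ʳ f)                  ≡⟨ X.rem-↑ʳ f ⟩
    map ((r G' ℕ.* r G) ℕ.*_) (rem G'' f)          ≡⟨ cong (λ c → map (c ℕ.*_) (rem G'' f)) (ℕ.*-comm (r G') (r G)) ⟩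
    map ((r G ℕ.* r G') ℕ.*_) (rem G'' f)          ≡⟨ map-*-map-* (r G) (r G') (rem G'' f) ⟨
    map (r G ℕ.*_) (map (r G' ℕ.*_) (rem G'' f))   ≡⟨ cong (map (r G ℕ.*_)) (Q.rem-↑ʳ f) ⟨
    map (r G ℕ.*_) (rem Q.C (m G' ↑ʳ f))           ≡⟨ Y.rem-↑ʳ (m G' ↑ʳ f) ⟨
    rem Y.C (m G ↑ʳ (m G' ↑ʳ f))                   ≡⟨ cong (rem Y.C) (+-assoc↔-↑ʳ (m G) (m G') (m G'') f) ⟨
    rem Y.C (Inverse.to edges ((m G ℕ.+ m G') ↑ʳ f)) ∎
    where open ≡-Reasoning
  ... | left e' with splitView (m G) (m G') e'
  ...   | left f = begin
    rem X.C ((f ↑ˡ m G') ↑ˡ m G'')                 ≡⟨ X.rem-↑ˡ (f ↑ˡ m G') ⟩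
    map (r G'' ℕ.*_) (rem P.C (f ↑ˡ m G'))         ≡⟨ cong (map (r G'' ℕ.*_)) (P.rem-↑ˡ f) ⟩
    map (r G'' ℕ.*_) (map (r G' ℕ.*_) (rem G f))   ≡⟨ map-*-map-* (r G'') (r G') (rem G f) ⟩
    map ((r G'' ℕ.* r G') ℕ.*_) (rem G f)          ≡⟨ Y.rem-↑ˡ f ⟨
    rem Y.C (f ↑ˡ (m G' ℕ.+ m G''))                ≡⟨ cong (rem Y.C) (+-assoc↔-↑ˡ↑ˡ (m G) (m G') (m G'') f) ⟨
    rem Y.C (Inverse.to edges ((f ↑ˡ m G') ↑ˡ m G'')) ∎
    where open ≡-Reasoning
  ...   | right f = begin
    rem X.C ((m G ↑ʳ f) ↑ˡ m G'')                  ≡⟨ X.rem-↑ˡ (m G ↑ʳ f) ⟩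
    map (r G'' ℕ.*_) (rem P.C (m G ↑ʳ f))          ≡⟨ cong (map (r G'' ℕ.*_)) (P.rem-↑ʳ f) ⟩
    map (r G'' ℕ.*_) (map (r G ℕ.*_) (rem G' f))   ≡⟨ map-*-map-* (r G'') (r G) (rem G' f) ⟩
    map ((r G'' ℕ.* r G) ℕ.*_) (rem G' f)          ≡⟨ cong (λ c → map (c ℕ.*_) (rem G' f)) (ℕ.*-comm (r G'') (r G)) ⟩
    map ((r G ℕ.* r G'') ℕ.*_) (rem G' f)          ≡⟨ map-*-map-* (r G) (r G'') (rem G' f) ⟨
    map (r G ℕ.*_) (map (r G'' ℕ.*_) (rem G' f))   ≡⟨ cong (map (r G ℕ.*_)) (Q.rem-↑ˡ f) ⟨
    map (r G ℕ.*_) (rem Q.C (f ↑ˡ m G''))          ≡⟨ Y.rem-↑ʳ (f ↑ˡ m G'') ⟨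
    rem Y.C (m G ↑ʳ (f ↑ˡ m G''))                  ≡⟨ cong (rem Y.C) (+-assoc↔-↑ʳ↑ˡ (m G) (m G') (m G'') f) ⟨
    rem Y.C (Inverse.to edges ((m G ↑ʳ f) ↑ˡ m G'')) ∎
    where open ≡-Reasoning

  ∘ʳ-assoc : ((G ∘ʳ G') ∘ʳ G'') ≅ (G ∘ʳ (G' ∘ʳ G''))
  ∘ʳ-assoc = mk≅ (mk↔ₛ′ to from to-from from-to) edges node≐ ports≡ rem≡
                 (to-G (root G)) (sym (ℕ.*-assoc (r G'') (r G') (r G)))

lemma5p2 :
    (∀ (G G' : PreGraph) (k : Fin (suc (n G))) (a : ℕ) → 0 < a →
       (hG : IsRG G) (hG' : IsRG G') → node G k ≐ ⟨ a ⟩ →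
       Σ (IsRG (compose G k a G')) λ h →
         (S (compose G k a G') ≐ ((r G' ⋅ S G) +ˢ (a ⋅ S G')))
         × (Bal (compose G k a G') h ≡ Bal G hG * Bal G' hG')
         × (Asym (compose G k a G') h ≡ (+ r G' / 1) * Asym G hG + (+ a / 1) * Asym G' hG')
         × (Symmetric G hG → Symmetric G' hG' → Symmetric (compose G k a G') h))
    × (∀ (G G' : PreGraph) → IsRG G → IsRG G' → (G ∘ʳ G') ≅ (G' ∘ʳ G))
    × (∀ (G G' G'' : PreGraph) → IsRG G → IsRG G' → IsRG G'' →
         ((G ∘ʳ G') ∘ʳ G'') ≅ (G ∘ʳ (G' ∘ʳ G'')))
lemma5p2 =
    (λ G G' k a 0<a hG hG' k≐⟨a⟩ →
       let open Composition.ReductionGraph G G' k a {{>-nonZero 0<a}} k≐⟨a⟩ hG hG'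
       in compose-isRG , S-compose , Bal-compose , Asym-compose , compose-symmetric)
  , (λ G G' hG hG' → Commutativity.∘ʳ-comm G G' hG hG')
  , (λ G G' G'' hG hG' hG'' → Associativity.∘ʳ-assoc G G' G'' hG hG' hG'')
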